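{- For any integers $1\le k\le n$, the $k$-equal partition lattice $\Pi_{n,k}$ is comodernistic.
   Context: $\Pi_{n,k}$ is the subposet of the partition lattice $\Pi_n$ of $[n]=\{1,\dots,n\}$ (ordered by refinement) consisting of all partitions whose non-singleton blocks have size at least $k$; it is a lattice. An element $m$ of a lattice $L$ is left-modular if $(x\vee m)\wedge y=x\vee(m\wedge y)$ for all $x<y$ in $L$. A lattice is comodernistic if every interval $[u,v]$ has a coatom that is left-modular as an element of $[u,v]$. -}

module Defs where

open import Level using (Level; _⊔_)
open import Data.Nat using (ℕ; _≤_; _≡ᵇ_)
open import Data.Bool using (Bool; T)
open import Data.Fin using (Fin)
open import Data.Fin.Subset using (∣_∣)
open import Data.Vec using (tabulate)
open import Data.Product using (Σ; _×_)
open import Data.Sum using (_⊎_)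
open import Relation.Nullary using (¬_)
open import Relation.Binary.PropositionalEquality using (_≡_)

-- Generic order-theoretic notions, for a carrier A with a partial order
-- _≼_ (equality of elements is taken to be mutual ≼, i.e. antisymmetry).

module Order {a ℓ : Level} {A : Set a} (_≼_ : A → A → Set ℓ) where

  _≈_ : A → A → Set ℓ
  x ≈ y = (x ≼ y) × (y ≼ x)

  _≺_ : A → A → Set ℓ
  x ≺ y = (x ≼ y) × ¬ (y ≼ x)

  InInterval : A → A → A → Set ℓ
  InInterval u v x = (u ≼ x) × (x ≼ v)

  IsJoinIn : A → A → A → A → A → Set (a ⊔ ℓ)
  IsJoinIn u v x y z =
    InInterval u v z × (x ≼ z) × (y ≼ z) ×
    (∀ w → InInterval u v w → x ≼ w → y ≼ w → z ≼ w)

  IsMeetIn : A → A → A → A → A → Set (a ⊔ ℓ)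
  IsMeetIn u v x y z =
    InInterval u v z × (z ≼ x) × (z ≼ y) ×
    (∀ w → InInterval u v w → w ≼ x → w ≼ y → w ≼ z)

  IsCoatomOf : A → A → A → Set (a ⊔ ℓ)
  IsCoatomOf u v c =
    (u ≼ c) × (c ≺ v) × (∀ x → c ≺ x → ¬ (x ≺ v))

  IsLeftModularIn : A → A → A → Set (a ⊔ ℓ)
  IsLeftModularIn u v m =
    ∀ x y → InInterval u v x → InInterval u v y → x ≺ y →
    ∀ xm b my d →
      IsJoinIn u v x m xm →
      IsMeetIn u v xm y b →
      IsMeetIn u v m y my →
      IsJoinIn u v x my d →
      b ≈ d

  Comodernistic : Set (a ⊔ ℓ)
  Comodernistic =
    ∀ u v → u ≺ v → Σ A (λ c → IsCoatomOf u v c × IsLeftModularIn u v c)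

-- Set partitions of [n] = Fin n, as equivalence relations
-- (i and j related iff they lie in the same block).

record Partition (n : ℕ) : Set where
  field
    same    : Fin n → Fin n → Bool
    refl′   : ∀ i → T (same i i)
    sym′    : ∀ i j → T (same i j) → T (same j i)
    trans′  : ∀ i j l → T (same i j) → T (same j l) → T (same i l)
open Partition public

blockSize : ∀ {n} → Partition n → Fin n → ℕ
blockSize p i = ∣ tabulate (same p i) ∣

_⊑_ : ∀ {n} → Partition n → Partition n → Set
p ⊑ q = ∀ i j → T (same p i j) → T (same q i j)

IsKEqual : ∀ {n} → ℕ → Partition n → Set
IsKEqual k p = ∀ i → (blockSize p i ≡ 1) ⊎ (k ≤ blockSize p i)

record Πnk (n k : ℕ) : Set where
  constructor ⟨_,_⟩
  field
    part   : Partition n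
    kequal : IsKEqual k part
open Πnk public

_≤Π_ : ∀ {n k} → Πnk n k → Πnk n k → Set
x ≤Π y = part x ⊑ part y

-- Let u < v and let B be a v-block that is not a u-block.  If no element of B is a
-- u-singleton, the coatom c splits B into the u-block of some a ∈ B and the rest, which
-- contains a non-singleton u-block and so has at least k elements.  If some a ∈ B is a
-- u-singleton, c splits {a} off B when |B| ≠ k, and shatters B into singletons when
-- |B| = k (every u-block inside B then has fewer than k elements, so is a singleton).
-- To see that c is left-modular, take x ≤ y in [u,v] with x ≰ c: then x joins the two parts
-- of B (in the shattering case: has all of B in one block), and the same operation applied
-- to the y-block of a gives w ≤ c ∧ y with y ≤ x ∨ w.  The exception is splitting {a} off a
-- y-block of exactly k elements, which would leave k - 1; there w shatters that block instead.

module Submission where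

open import Defs
open import Level using (Level; _⊔_)
open import Data.Empty using (⊥-elim)
open import Data.Unit using (tt)
open import Data.Bool as Bool using (Bool; true; false; T)
open import Data.Bool.Properties using (T-≡)
open import Data.Nat as ℕ using (ℕ; suc; _≤_; _<_; s≤s)
open import Data.Nat.Properties
  using (≤-refl; ≤-reflexive; ≤-trans; ≤-antisym; <-irrefl; <⇒≱; ≤-pred; n≤1+n; ≤∧≢⇒<)
open import Data.Fin as Fin using (Fin; zero; suc)
open import Data.Fin.Properties using (all?; any?; ¬∀⟶∃¬)
open import Data.Fin.Subset using (Subset; inside; outside; _∈_; _⊆_; ⁅_⁆; ∣_∣)
open import Data.Fin.Subset.Properties
  using (_∈?_; p⊆q⇒∣p∣≤∣q∣; p⊂q⇒∣p∣<∣q∣; ∣p∣≤∣x∷p∣; drop-there; ⊆-antisym; x∈⁅x⁆; x∈⁅y⁆⇒x≡y; ∣⁅x⁆∣≡1)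
open import Data.Vec using (_∷_; here; there; tabulate)
open import Data.Vec.Properties using (lookup∘tabulate; lookup⇒[]=; []=⇒lookup)
open import Data.Product using (Σ; _×_; _,_; proj₁; proj₂)
open import Data.Sum using (_⊎_; inj₁; inj₂)
open import Function using (case_of_)
open import Function.Bundles using (Equivalence)
open import Relation.Nullary using (¬_; Dec; yes; no)
open import Relation.Nullary.Decidable
  using (T?; isYes; toWitness; fromWitness; _→-dec_; _×-dec_; _⊎-dec_; ¬?)
open import Relation.Binary.Structures using (IsDecEquivalence)
open import Relation.Binary.PropositionalEquality
  using (_≡_; _≢_; refl; sym; trans; cong; subst; ≢-sym)

module _ {a ℓ : Level} {A : Set a} (_≼_ : A → A → Set ℓ) where
  open Order _≼_

  -- A recovery of y from x at c: some w ≤ c ∧ y in [u,v] with y ≤ x ∨ w.  Having one whenever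
  -- x ≤ y and x ≰ c is the non-trivial half of (x ∨ c) ∧ y = x ∨ (c ∧ y).
  Recovery : A → A → A → A → A → Set (a ⊔ ℓ)
  Recovery u v c x y = Σ A λ w → InInterval u v w × (w ≼ c) × (w ≼ y) × (∀ d → x ≼ d → w ≼ d → y ≼ d)

  Recovers : A → A → A → Set (a ⊔ ℓ)
  Recovers u v c = ∀ x y → InInterval u v x → InInterval u v y → x ≼ y → ¬ (x ≼ c) → Recovery u v c x y

  isCoatomOf : ∀ u v c → u ≼ c → c ≺ v →
    (∀ z → c ≼ z → z ≼ v → ¬ (z ≼ c) → v ≼ z) → IsCoatomOf u v c
  isCoatomOf _ _ _ u≼c c≺v maximal =
    u≼c , c≺v , λ { z (c≼z , z⋠c) (z≼v , v⋠z) → v⋠z (maximal z c≼z z≼v z⋠c) }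

  isLeftModularIn : (∀ {x} → x ≼ x) → (∀ {x y z} → x ≼ y → y ≼ z → x ≼ z) →
    ∀ u v c → (∀ x → Dec (x ≼ c)) → InInterval u v c → Recovers u v c →
    IsLeftModularIn u v c
  isLeftModularIn ≼-refl ≼-trans u v c _≼c? c∈[u,v] recovers x y x∈ y∈ (x≼y , _) xm b my d
    (_ , x≼xm , c≼xm , xm-least) (b∈ , b≼xm , b≼y , b-greatest)
    (my∈ , my≼c , my≼y , my-greatest) (_ , x≼d , my≼d , d-least) = b≼d (x ≼c?) , d≼b
    where
    d≼b : d ≼ b
    d≼b = d-least b b∈ (b-greatest x x∈ x≼xm x≼y) (b-greatest my my∈ (≼-trans my≼c c≼xm) my≼y)
    b≼d : Dec (x ≼ c) → b ≼ d
    b≼d (yes x≼c) = ≼-trans (my-greatest b b∈ (≼-trans b≼xm (xm-least c c∈[u,v] x≼c ≼-refl)) b≼y) my≼d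
    b≼d (no x⋠c) with recovers x y x∈ y∈ x≼y x⋠c
    ... | w , w∈ , w≼c , w≼y , y≼ = ≼-trans b≼y (y≼ d x≼d (≼-trans (my-greatest w w∈ w≼c w≼y) my≼d))

p-x⊆q⇒∣p∣≤1+∣q∣ : ∀ {n} {p q : Subset n} x → (∀ {y} → y ∈ p → y ≢ x → y ∈ q) →
  ∣ p ∣ ≤ suc ∣ q ∣
p-x⊆q⇒∣p∣≤1+∣q∣ {p = s ∷ p} {t ∷ q} zero p-x⊆q =
  ≤-trans (∣s∷p∣≤1+∣p∣ s) (s≤s (≤-trans (p⊆q⇒∣p∣≤∣q∣ p⊆q) (∣p∣≤∣x∷p∣ t q)))
  where
  p⊆q : p ⊆ q
  p⊆q y∈p = drop-there (p-x⊆q (there y∈p) λ ())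
  ∣s∷p∣≤1+∣p∣ : ∀ s → ∣ s ∷ p ∣ ≤ suc ∣ p ∣
  ∣s∷p∣≤1+∣p∣ inside  = ≤-refl
  ∣s∷p∣≤1+∣p∣ outside = n≤1+n ∣ p ∣
p-x⊆q⇒∣p∣≤1+∣q∣ {p = s ∷ p} {t ∷ q} (suc x) p-x⊆q = go s t (λ zero∈ → p-x⊆q zero∈ λ ())
  where
  ih : ∣ p ∣ ≤ suc ∣ q ∣
  ih = p-x⊆q⇒∣p∣≤1+∣q∣ x λ y∈p y≢x → drop-there (p-x⊆q (there y∈p) λ { refl → y≢x refl })
  go : ∀ s t → (zero ∈ s ∷ p → zero ∈ t ∷ q) → ∣ s ∷ p ∣ ≤ suc ∣ t ∷ q ∣
  go outside t _ = ≤-trans ih (s≤s (∣p∣≤∣x∷p∣ t q))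
  go inside  t zero∈ with zero∈ here
  ... | here = s≤s ih

p⊆q∧∣q∣≤∣p∣⇒q⊆p : ∀ {n} {p q : Subset n} → p ⊆ q → ∣ q ∣ ≤ ∣ p ∣ → q ⊆ p
p⊆q∧∣q∣≤∣p∣⇒q⊆p {p = p} p⊆q ∣q∣≤∣p∣ {x} x∈q with x ∈? p
... | yes x∈p = x∈p
... | no  x∉p = ⊥-elim (<⇒≱ (p⊂q⇒∣p∣<∣q∣ (p⊆q , x , x∈q , x∉p)) ∣q∣≤∣p∣)

T⇒≡true : ∀ {b} → T b → b ≡ true
T⇒≡true = Equivalence.to T-≡

≡true⇒T : ∀ {b} → b ≡ true → T b
≡true⇒T = Equivalence.from T-≡

¬T⇒≡false : ∀ {b} → ¬ T b → b ≡ false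
¬T⇒≡false {false} _  = refl
¬T⇒≡false {true}  ¬t = ⊥-elim (¬t tt)

module _ {n : ℕ} where

  private variable
    i j l m : Fin n

  infix 4 _∼[_]_

  _∼[_]_ : Fin n → Partition n → Fin n → Set
  i ∼[ p ] j = T (same p i j)

  ∼-sym : ∀ p {i j} → i ∼[ p ] j → j ∼[ p ] i
  ∼-sym p = sym′ p _ _

  ∼-trans : ∀ p {i j l} → i ∼[ p ] j → j ∼[ p ] l → i ∼[ p ] l
  ∼-trans p = trans′ p _ _ _

  ∼-dec : ∀ p i j → Dec (i ∼[ p ] j)
  ∼-dec p i j = T? (same p i j)

  ⊑-refl : ∀ {p : Partition n} → p ⊑ p
  ⊑-refl i j i∼j = i∼j

  ⊑-trans : ∀ {p q r : Partition n} → p ⊑ q → q ⊑ r → p ⊑ r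
  ⊑-trans p⊑q q⊑r i j i∼j = q⊑r i j (p⊑q i j i∼j)

  ⊑-dec : ∀ p q → Dec (p ⊑ q)
  ⊑-dec p q = all? λ i → all? λ j → ∼-dec p i j →-dec ∼-dec q i j

  ⋢⇒pair : ∀ p q → ¬ (p ⊑ q) → Σ (Fin n) λ i → Σ (Fin n) λ j → i ∼[ p ] j × ¬ (i ∼[ q ] j)
  ⋢⇒pair p q p⋢q
    with i , ¬i⊑ ← ¬∀⟶∃¬ n _ (λ i → all? λ j → ∼-dec p i j →-dec ∼-dec q i j) p⋢q
    with j , ¬ij⊑ ← ¬∀⟶∃¬ n _ (λ j → ∼-dec p i j →-dec ∼-dec q i j) ¬i⊑
    with ∼-dec p i j
  ... | yes i∼j = i , j , i∼j , λ i∼′j → ¬ij⊑ λ _ → i∼′j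
  ... | no  i≁j = ⊥-elim (¬ij⊑ λ i∼j → ⊥-elim (i≁j i∼j))

  distinct-neighbour : ∀ p {a a′ b} → a ∼[ p ] a′ → a ∼[ p ] b → a ≢ b →
    Σ (Fin n) λ b′ → a′ ∼[ p ] b′ × a′ ≢ b′
  distinct-neighbour p {a} {a′} {b} a∼a′ a∼b a≢b with a′ Fin.≟ a
  ... | yes refl  = b , a∼b , a≢b
  ... | no  a′≢a = a , ∼-sym p a∼a′ , a′≢a

  -- blockSize p i is ∣ block p i ∣ definitionally
  block : Partition n → Fin n → Subset n
  block p i = tabulate (same p i)

  ∈-block⁺ : ∀ p i → i ∼[ p ] j → j ∈ block p i
  ∈-block⁺ {j} p i i∼j = lookup⇒[]= j _ (trans (lookup∘tabulate (same p i) j) (T⇒≡true i∼j))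

  ∈-block⁻ : ∀ p i → j ∈ block p i → i ∼[ p ] j
  ∈-block⁻ {j} p i j∈ = ≡true⇒T (trans (sym (lookup∘tabulate (same p i) j)) ([]=⇒lookup j∈))

  module _ (p : Partition n) (i : Fin n) (q : Partition n) (j : Fin n)
           (p⊆q : ∀ {l} → i ∼[ p ] l → j ∼[ q ] l) where

    block⊆block : block p i ⊆ block q j
    block⊆block l∈ = ∈-block⁺ q j (p⊆q (∈-block⁻ p i l∈))

    blockSize-mono : blockSize p i ≤ blockSize q j
    blockSize-mono = p⊆q⇒∣p∣≤∣q∣ block⊆block

    blockSize-strict : j ∼[ q ] m → ¬ (i ∼[ p ] m) → blockSize p i < blockSize q j
    blockSize-strict j∼m i≁m =
      p⊂q⇒∣p∣<∣q∣ (block⊆block , _ , ∈-block⁺ q j j∼m , λ m∈ → i≁m (∈-block⁻ p i m∈))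

    blockSize-fill : blockSize q j ≤ blockSize p i → j ∼[ q ] l → i ∼[ p ] l
    blockSize-fill ∣q∣≤∣p∣ j∼l = ∈-block⁻ p i (p⊆q∧∣q∣≤∣p∣⇒q⊆p block⊆block ∣q∣≤∣p∣ (∈-block⁺ q j j∼l))

  kEqual-sameBlock : ∀ {k} p i q j →
    (∀ {l} → i ∼[ p ] l → j ∼[ q ] l) → (∀ {l} → j ∼[ q ] l → i ∼[ p ] l) →
    IsKEqual k q → blockSize p i ≡ 1 ⊎ k ≤ blockSize p i
  kEqual-sameBlock {k} p i q j p⊆q q⊆p q-kEqual =
    subst (λ m → m ≡ 1 ⊎ k ≤ m) (≤-antisym (blockSize-mono q j p i q⊆p) (blockSize-mono p i q j p⊆q))
      (q-kEqual j)

  blockSize≤1+ : ∀ p i q j a → (∀ {l} → i ∼[ p ] l → l ≢ a → j ∼[ q ] l) →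
    blockSize p i ≤ suc (blockSize q j)
  blockSize≤1+ p i q j a p-a⊆q =
    p-x⊆q⇒∣p∣≤1+∣q∣ a (λ l∈ l≢a → ∈-block⁺ q j (p-a⊆q (∈-block⁻ p i l∈) l≢a))

  ⁅i⁆⊆block : ∀ p i → ⁅ i ⁆ ⊆ block p i
  ⁅i⁆⊆block p i j∈ rewrite x∈⁅y⁆⇒x≡y i j∈ = ∈-block⁺ p i (refl′ p i)

  blockSize≡1⇒ : ∀ p → blockSize p i ≡ 1 → i ∼[ p ] j → i ≡ j
  blockSize≡1⇒ {i} {j} p size≡1 i∼j with i Fin.≟ j
  ... | yes i≡j = i≡j
  ... | no  i≢j = ⊥-elim (<-irrefl (sym size≡1) (subst (_< blockSize p i) (∣⁅x⁆∣≡1 i)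
          (p⊂q⇒∣p∣<∣q∣ (⁅i⁆⊆block p i , j , ∈-block⁺ p i i∼j , λ j∈ → i≢j (sym (x∈⁅y⁆⇒x≡y i j∈))))))

  ⇒blockSize≡1 : ∀ p → (∀ {j} → i ∼[ p ] j → i ≡ j) → blockSize p i ≡ 1
  ⇒blockSize≡1 {i} p trivial = trans (cong ∣_∣ (⊆-antisym block⊆⁅i⁆ (⁅i⁆⊆block p i))) (∣⁅x⁆∣≡1 i)
    where
    block⊆⁅i⁆ : block p i ⊆ ⁅ i ⁆
    block⊆⁅i⁆ j∈ = subst (_∈ ⁅ i ⁆) (trivial (∈-block⁻ p i j∈)) (x∈⁅x⁆ i)

  kEqual-large : ∀ {k} p → IsKEqual k p → i ∼[ p ] j → i ≢ j → k ≤ blockSize p i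
  kEqual-large {i} p kequal i∼j i≢j with kequal i
  ... | inj₁ size≡1 = ⊥-elim (i≢j (blockSize≡1⇒ p size≡1 i∼j))
  ... | inj₂ k≤size = k≤size

  module _ {_≈_ : Fin n → Fin n → Set} (≈-isDecEquivalence : IsDecEquivalence _≈_) where
    open IsDecEquivalence ≈-isDecEquivalence
      using () renaming (_≟_ to _≈?_; refl to ≈-refl; sym to ≈-sym; trans to ≈-trans)

    fromDecEquivalence : Partition n
    fromDecEquivalence = record
      { same   = λ i j → isYes (i ≈? j)
      ; refl′  = λ i → fromWitness ≈-refl
      ; sym′   = λ i j i≈j → fromWitness (≈-sym (toWitness i≈j))
      ; trans′ = λ i j l i≈j j≈l → fromWitness (≈-trans (toWitness i≈j) (toWitness j≈l))
      }

    ∼-fromDecEquivalence⁺ : i ≈ j → i ∼[ fromDecEquivalence ] j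
    ∼-fromDecEquivalence⁺ = fromWitness

    ∼-fromDecEquivalence⁻ : i ∼[ fromDecEquivalence ] j → i ≈ j
    ∼-fromDecEquivalence⁻ = toWitness

  same-resp : ∀ q a → i ∼[ q ] j → same q a i ≡ same q a j
  same-resp {i} {j} q a i∼j with ∼-dec q a i
  ... | yes a∼i = trans (T⇒≡true a∼i) (sym (T⇒≡true (∼-trans q a∼i i∼j)))
  ... | no  a≁i = trans (¬T⇒≡false a≁i) (sym (¬T⇒≡false (λ a∼j → a≁i (∼-trans q a∼j (∼-sym q i∼j)))))

  SplitBy : Partition n → (Fin n → Bool) → Fin n → Fin n → Set
  SplitBy p s i j = i ∼[ p ] j × s i ≡ s j

  splitBy-isDecEquivalence : ∀ p s → IsDecEquivalence (SplitBy p s)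
  splitBy-isDecEquivalence p s = record
    { isEquivalence = record
      { refl  = refl′ p _ , refl
      ; sym   = λ (i∼j , sᵢ≡sⱼ) → ∼-sym p i∼j , sym sᵢ≡sⱼ
      ; trans = λ (i∼j , sᵢ≡sⱼ) (j∼l , sⱼ≡sₗ) → ∼-trans p i∼j j∼l , trans sᵢ≡sⱼ sⱼ≡sₗ
      }
    ; _≟_ = λ i j → ∼-dec p i j ×-dec (s i Bool.≟ s j)
    }

  split : Partition n → (Fin n → Bool) → Partition n
  split p s = fromDecEquivalence (splitBy-isDecEquivalence p s)

  Crosses : Partition n → (Fin n → Bool) → Set
  Crosses x s = Σ (Fin n) λ i → Σ (Fin n) λ j → i ∼[ x ] j × s i ≡ true × s j ≡ false

  module _ (p : Partition n) (s : Fin n → Bool) where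

    ∼-split⁺ : i ∼[ p ] j → s i ≡ s j → i ∼[ split p s ] j
    ∼-split⁺ i∼j sᵢ≡sⱼ = ∼-fromDecEquivalence⁺ (splitBy-isDecEquivalence p s) (i∼j , sᵢ≡sⱼ)

    ∼-split⁻ : i ∼[ split p s ] j → SplitBy p s i j
    ∼-split⁻ = ∼-fromDecEquivalence⁻ (splitBy-isDecEquivalence p s)

    split-⊑ : split p s ⊑ p
    split-⊑ i j i∼j = proj₁ (∼-split⁻ i∼j)

    ⊑-split : ∀ q → q ⊑ p → (∀ {i j} → i ∼[ q ] j → s i ≡ s j) → q ⊑ split p s
    ⊑-split q q⊑p s-resp i j i∼j = ∼-split⁺ (q⊑p i j i∼j) (s-resp i∼j)

    split-crossing : ∀ x → x ⊑ p → ¬ (x ⊑ split p s) → Crosses x s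
    split-crossing x x⊑p x⋢split with i , j , i∼j , i≁j ← ⋢⇒pair x (split p s) x⋢split =
      go (s i) (s j) refl refl
      where
      go : ∀ b b′ → s i ≡ b → s j ≡ b′ → Crosses x s
      go true  false sᵢ sⱼ = i , j , i∼j , sᵢ , sⱼ
      go false true  sᵢ sⱼ = j , i , ∼-sym x i∼j , sⱼ , sᵢ
      go true  true  sᵢ sⱼ = ⊥-elim (i≁j (∼-split⁺ (x⊑p i j i∼j) (trans sᵢ (sym sⱼ))))
      go false false sᵢ sⱼ = ⊥-elim (i≁j (∼-split⁺ (x⊑p i j i∼j) (trans sᵢ (sym sⱼ))))

  split-mono : ∀ p q s → p ⊑ q → split p s ⊑ split q s
  split-mono p q s p⊑q =
    ⊑-split q s (split p s) (λ i j i∼j → p⊑q i j (split-⊑ p s i j i∼j))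
      (λ i∼j → proj₂ (∼-split⁻ p s i∼j))

  split-join : ∀ y x d s → (∀ {i j} → s i ≡ true → s j ≡ true → i ∼[ y ] j) →
    x ⊑ y → Crosses x s → x ⊑ d → split y s ⊑ d → y ⊑ d
  split-join y x d s uBlock-related x⊑y (i , j , i∼j , sᵢ , sⱼ) x⊑d split⊑d i′ j′ i′∼j′ =
    go (s i′) (s j′) refl refl
    where
    across : ∀ {i′ j′} → i′ ∼[ y ] j′ → s i′ ≡ true → s j′ ≡ false → i′ ∼[ d ] j′
    across i′∼j′ sᵢ′ sⱼ′ =
      ∼-trans d (split⊑d _ _ (∼-split⁺ y s (uBlock-related sᵢ′ sᵢ) (trans sᵢ′ (sym sᵢ))))
      (∼-trans d (x⊑d _ _ i∼j)
      (split⊑d _ _ (∼-split⁺ y s j∼j′ (trans sⱼ (sym sⱼ′)))))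
      where
      j∼j′ = ∼-trans y (∼-sym y (x⊑y _ _ i∼j)) (∼-trans y (uBlock-related sᵢ sᵢ′) i′∼j′)
    go : ∀ b b′ → s i′ ≡ b → s j′ ≡ b′ → i′ ∼[ d ] j′
    go true  false sᵢ′ sⱼ′ = across i′∼j′ sᵢ′ sⱼ′
    go false true  sᵢ′ sⱼ′ = ∼-sym d (across (∼-sym y i′∼j′) sⱼ′ sᵢ′)
    go true  true  sᵢ′ sⱼ′ = split⊑d i′ j′ (∼-split⁺ y s i′∼j′ (trans sᵢ′ (sym sⱼ′)))
    go false false sᵢ′ sⱼ′ = split⊑d i′ j′ (∼-split⁺ y s i′∼j′ (trans sᵢ′ (sym sⱼ′)))

  split-kEqual : ∀ {k} p q a → IsKEqual k p → IsKEqual k q → q ⊑ p →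
    (∀ {i} → a ∼[ p ] i → ¬ (a ∼[ q ] i) → k ≤ blockSize (split p (same q a)) i) →
    IsKEqual k (split p (same q a))
  split-kEqual p q a p-kEqual q-kEqual q⊑p rest-large i with ∼-dec q a i | ∼-dec p a i
  ... | yes a∼i | _ = kEqual-sameBlock P i q i ⊆q q⊆ q-kEqual
    where
    P = split p (same q a)
    ⊆q : ∀ {l} → i ∼[ P ] l → i ∼[ q ] l
    ⊆q i∼l = ∼-trans q (∼-sym q a∼i)
      (≡true⇒T (trans (sym (proj₂ (∼-split⁻ p (same q a) i∼l))) (T⇒≡true a∼i)))
    q⊆ : ∀ {l} → i ∼[ q ] l → i ∼[ P ] l
    q⊆ i∼l = ∼-split⁺ p (same q a) (q⊑p _ _ i∼l) (same-resp q a i∼l)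
  ... | no a≁qi | yes a∼i = inj₂ (rest-large a∼i a≁qi)
  ... | no a≁qi | no a≁i = kEqual-sameBlock P i p i ⊆p p⊆ p-kEqual
    where
    P = split p (same q a)
    ⊆p : ∀ {l} → i ∼[ P ] l → i ∼[ p ] l
    ⊆p i∼l = proj₁ (∼-split⁻ p (same q a) i∼l)
    p⊆ : ∀ {l} → i ∼[ p ] l → i ∼[ P ] l
    p⊆ i∼l = ∼-split⁺ p (same q a) i∼l
      (trans (¬T⇒≡false a≁qi) (sym (¬T⇒≡false (λ a∼l → a≁i (∼-trans p (q⊑p _ _ a∼l) (∼-sym p i∼l))))))

  ⊑⇒blockSize≤ : ∀ p q i → p ⊑ q → blockSize p i ≤ blockSize q i
  ⊑⇒blockSize≤ p q i p⊑q = blockSize-mono p i q i (p⊑q _ _)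

  Shatter : Partition n → Fin n → Fin n → Fin n → Set
  Shatter p a i j = i ≡ j ⊎ (i ∼[ p ] j × ¬ (a ∼[ p ] i))

  shatter-isDecEquivalence : ∀ p a → IsDecEquivalence (Shatter p a)
  shatter-isDecEquivalence p a = record
    { isEquivalence = record { refl = inj₁ refl ; sym = sym′′ ; trans = trans′′ }
    ; _≟_ = λ i j → (i Fin.≟ j) ⊎-dec (∼-dec p i j ×-dec ¬? (∼-dec p a i))
    }
    where
    sym′′ : Shatter p a i j → Shatter p a j i
    sym′′ (inj₁ i≡j)         = inj₁ (sym i≡j)
    sym′′ (inj₂ (i∼j , a≁i)) = inj₂ (∼-sym p i∼j , λ a∼j → a≁i (∼-trans p a∼j (∼-sym p i∼j)))
    trans′′ : Shatter p a i j → Shatter p a j l → Shatter p a i l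
    trans′′ (inj₁ refl)        j~l                = j~l
    trans′′ (inj₂ i~j)         (inj₁ refl)        = inj₂ i~j
    trans′′ (inj₂ (i∼j , a≁i)) (inj₂ (j∼l , _)) = inj₂ (∼-trans p i∼j j∼l , a≁i)

  shatter : Partition n → Fin n → Partition n
  shatter p a = fromDecEquivalence (shatter-isDecEquivalence p a)

  module _ (p : Partition n) (a : Fin n) where

    ∼-shatter⁺ : Shatter p a i j → i ∼[ shatter p a ] j
    ∼-shatter⁺ = ∼-fromDecEquivalence⁺ (shatter-isDecEquivalence p a)

    ∼-shatter⁻ : i ∼[ shatter p a ] j → Shatter p a i j
    ∼-shatter⁻ = ∼-fromDecEquivalence⁻ (shatter-isDecEquivalence p a)

    shatter-⊑ : shatter p a ⊑ p
    shatter-⊑ i j i∼j with ∼-shatter⁻ i∼j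
    ... | inj₁ refl       = refl′ p i
    ... | inj₂ (i∼j , _) = i∼j

    ⊑-shatter : ∀ q → q ⊑ p → (∀ {i j} → a ∼[ p ] i → i ∼[ q ] j → i ≡ j) → q ⊑ shatter p a
    ⊑-shatter q q⊑p trivial i j i∼j = ∼-shatter⁺ (case ∼-dec p a i of λ where
      (yes a∼i) → inj₁ (trivial a∼i i∼j)
      (no  a≁i) → inj₂ (q⊑p i j i∼j , a≁i))

    shatter-kEqual : ∀ {k} → IsKEqual k p → IsKEqual k (shatter p a)
    shatter-kEqual p-kEqual i = case ∼-dec p a i of λ where
        (yes a∼i) → inj₁ (⇒blockSize≡1 (shatter p a) (singleton a∼i))
        (no  a≁i) → kEqual-sameBlock (shatter p a) i p i (shatter-⊑ i _) (unchanged a≁i) p-kEqual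
      where
      singleton : a ∼[ p ] i → i ∼[ shatter p a ] j → i ≡ j
      singleton a∼i i∼j with ∼-shatter⁻ i∼j
      ... | inj₁ i≡j       = i≡j
      ... | inj₂ (_ , a≁i) = ⊥-elim (a≁i a∼i)
      unchanged : ¬ (a ∼[ p ] i) → i ∼[ p ] l → i ∼[ shatter p a ] l
      unchanged a≁i i∼l = ∼-shatter⁺ (inj₂ (i∼l , a≁i))

  shatter-join : ∀ y x d a → (∀ {l} → a ∼[ y ] l → a ∼[ x ] l) → x ⊑ d → shatter y a ⊑ d → y ⊑ d
  shatter-join y x d a block⊆ x⊑d shatter⊑d i j i∼j with ∼-dec y a i
  ... | yes a∼i = x⊑d i j (∼-trans x (∼-sym x (block⊆ a∼i)) (block⊆ (∼-trans y a∼i i∼j)))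
  ... | no  a≁i = shatter⊑d i j (∼-shatter⁺ y a (inj₂ (i∼j , a≁i)))

  -- x has a block of at least k elements inside the p-block of a.
  ⋢shatter⇒block⊆ : ∀ {k} p x a → x ⊑ p → IsKEqual k x → blockSize p a ≤ k → ¬ (x ⊑ shatter p a) →
    a ∼[ p ] l → a ∼[ x ] l
  ⋢shatter⇒block⊆ {k = k} p x a x⊑p x-kEqual ∣p∣≤k x⋢shatter a∼l
    with i , j , i∼j , i≁j ← ⋢⇒pair x (shatter p a) x⋢shatter = case ∼-dec p a i of λ where
        (no  a≁i) → ⊥-elim (i≁j (∼-shatter⁺ p a (inj₂ (x⊑p i j i∼j , a≁i))))
        (yes a∼i) → ∼-trans x (∼-sym x (fill a∼i (refl′ p a))) (fill a∼i a∼l)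
    where
    i≢j : i ≢ j
    i≢j i≡j = i≁j (∼-shatter⁺ p a (inj₁ i≡j))
    fill : a ∼[ p ] i → a ∼[ p ] m → i ∼[ x ] m
    fill a∼i = blockSize-fill x i p a (λ i∼m → ∼-trans p a∼i (x⊑p _ _ i∼m))
                 (≤-trans ∣p∣≤k (kEqual-large x x-kEqual i∼j i≢j))

  shatter⊑split : ∀ p q a → q ⊑ p → shatter p a ⊑ split p (same q a)
  shatter⊑split p q a q⊑p = ⊑-split p (same q a) (shatter p a) (shatter-⊑ p a) resp
    where
    resp : i ∼[ shatter p a ] j → same q a i ≡ same q a j
    resp i∼j with ∼-shatter⁻ p a i∼j
    ... | inj₁ refl = refl
    ... | inj₂ (i∼j , a≁i) = trans (¬T⇒≡false (λ a∼i → a≁i (q⊑p _ _ a∼i)))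
          (sym (¬T⇒≡false (λ a∼j → a≁i (∼-trans p (q⊑p _ _ a∼j) (∼-sym p i∼j)))))

  shatter-mono : ∀ y p a → y ⊑ p → (∀ {l} → a ∼[ p ] l → a ∼[ y ] l) → shatter y a ⊑ shatter p a
  shatter-mono y p a y⊑p block⊆ =
    ⊑-shatter p a (shatter y a) (λ i j i∼j → y⊑p i j (shatter-⊑ y a i j i∼j)) trivial
    where
    trivial : a ∼[ p ] i → i ∼[ shatter y a ] j → i ≡ j
    trivial a∼i i∼j with ∼-shatter⁻ y a i∼j
    ... | inj₁ i≡j       = i≡j
    ... | inj₂ (_ , a≁i) = ⊥-elim (a≁i (block⊆ a∼i))

  -- Every other q-block inside the p-block of a misses a, so has fewer than k elements.
  singletonuBlock-related : ∀ {k} q p a → IsKEqual k q → q ⊑ p → blockSize q a ≡ 1 → blockSize p a ≤ k →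
    a ∼[ p ] i → i ∼[ q ] j → i ≡ j
  singletonuBlock-related {i} {j} {k} q p a q-kEqual q⊑p a-singleton ∣p∣≤k a∼i i∼j with i Fin.≟ j
  ... | yes i≡j = i≡j
  ... | no  i≢j = ⊥-elim (<⇒≱ (≤-trans (s≤s (kEqual-large q q-kEqual i∼j i≢j)) ∣q∣<∣p∣) ∣p∣≤k)
    where
    i≁a : ¬ (i ∼[ q ] a)
    i≁a i∼a with refl ← blockSize≡1⇒ q a-singleton (∼-sym q i∼a) = i≢j (blockSize≡1⇒ q a-singleton i∼j)
    ∣q∣<∣p∣ : blockSize q i < blockSize p a
    ∣q∣<∣p∣ = blockSize-strict q i p a (λ i∼l → ∼-trans p a∼i (q⊑p _ _ i∼l)) (refl′ p a) i≁a

  blockSize≤1+split : ∀ p q a → blockSize q a ≡ 1 → a ∼[ p ] i → ¬ (a ∼[ q ] i) →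
    blockSize p a ≤ suc (blockSize (split p (same q a)) i)
  blockSize≤1+split {i} p q a a-singleton a∼i a≁i = blockSize≤1+ p a (split p (same q a)) i a rest⊆
    where
    rest⊆ : a ∼[ p ] l → l ≢ a → i ∼[ split p (same q a) ] l
    rest⊆ a∼l l≢a = ∼-split⁺ p (same q a) (∼-trans p (∼-sym p a∼i) a∼l)
      (trans (¬T⇒≡false a≁i) (sym (¬T⇒≡false (λ a∼l → l≢a (sym (blockSize≡1⇒ q a-singleton a∼l))))))

module _ {n k : ℕ} (u v : Πnk n k) (u⊑v : u ≤Π v) where
  open Order (_≤Π_ {n} {k})

  private
    U = part u
    V = part v

  LeftModularCoatom : Set
  LeftModularCoatom = Σ (Πnk n k) λ c → IsCoatomOf u v c × IsLeftModularIn u v c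

  leftModularCoatom : ∀ c → u ≤Π c → c ≤Π v → ¬ (v ≤Π c) →
    (∀ z → c ≤Π z → z ≤Π v → ¬ (z ≤Π c) → v ≤Π z) → Recovers _≤Π_ u v c → LeftModularCoatom
  leftModularCoatom c u≤c c≤v v≰c maximal recovers =
    c , isCoatomOf _≤Π_ u v c u≤c (c≤v , v≰c) maximal ,
    isLeftModularIn _≤Π_
      (λ {x} → ⊑-refl {p = part x}) (λ {x} {y} {z} → ⊑-trans {p = part x} {part y} {part z})
      u v c (λ x → ⊑-dec (part x) (part c)) (u≤c , c≤v) recovers

  u≤split : ∀ a y → u ≤Π y → U ⊑ split (part y) (same U a)
  u≤split a y u≤y = ⊑-split (part y) (same U a) U u≤y (same-resp U a)

  uBlock-related : ∀ a y → u ≤Π y → ∀ {i j} → same U a i ≡ true → same U a j ≡ true → i ∼[ part y ] j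
  uBlock-related a y u≤y sᵢ sⱼ = u≤y _ _ (∼-trans U (∼-sym U (≡true⇒T sᵢ)) (≡true⇒T sⱼ))

  module SplitCoatom (a b : Fin n) (a∼b : a ∼[ V ] b) (a≁b : ¬ (a ∼[ U ] b))
                     (c-kEqual : IsKEqual k (split V (same U a))) where
    s = same U a

    c : Πnk n k
    c = ⟨ split V s , c-kEqual ⟩

    v≰c : ¬ (v ≤Π c)
    v≰c v≤c with () ← trans (sym (T⇒≡true (refl′ U a)))
                             (trans (proj₂ (∼-split⁻ V s (v≤c a b a∼b))) (¬T⇒≡false a≁b))

    maximal : ∀ z → c ≤Π z → z ≤Π v → ¬ (z ≤Π c) → v ≤Π z
    maximal z c≤z z≤v z≰c =
      split-join V (part z) (part z) s (uBlock-related a v u⊑v) z≤v (split-crossing V s (part z) z≤v z≰c)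
        (⊑-refl {p = part z}) c≤z

    recoveredBy-split : ∀ x y → InInterval u v x → InInterval u v y → x ≤Π y → ¬ (x ≤Π c) →
      IsKEqual k (split (part y) s) → Recovery _≤Π_ u v c x y
    recoveredBy-split x y (_ , x≤v) (u≤y , y≤v) x≤y x≰c w-kEqual =
      ⟨ split Y s , w-kEqual ⟩ , (u≤split a y u≤y , λ i j i∼j → y≤v i j (split-⊑ Y s i j i∼j)) ,
      split-mono Y V s y≤v , split-⊑ Y s ,
      λ d x≤d w≤d → split-join Y (part x) (part d) s (uBlock-related a y u≤y) x≤y
                      (split-crossing V s (part x) x≤v x≰c) x≤d w≤d
      where Y = part y

    coatom : Recovers _≤Π_ u v c → LeftModularCoatom
    coatom = leftModularCoatom c (u≤split a v u⊑v) (split-⊑ V s) v≰c maximal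

  module ShatterAt (a : Fin n) (a-singleton : blockSize U a ≡ 1) where

    shatterΠ : Πnk n k → Πnk n k
    shatterΠ y = ⟨ shatter (part y) a , shatter-kEqual (part y) a (kequal y) ⟩

    u≤shatter : ∀ y → u ≤Π y → blockSize (part y) a ≤ k → u ≤Π shatterΠ y
    u≤shatter y u≤y ∣y∣≤k =
      ⊑-shatter (part y) a U u≤y (singletonuBlock-related U (part y) a (kequal u) u≤y a-singleton ∣y∣≤k)

    recoveredBy-shatter : ∀ c x y → InInterval u v y → blockSize (part y) a ≤ k →
      (∀ {l} → a ∼[ part y ] l → a ∼[ part x ] l) → shatterΠ y ≤Π c → Recovery _≤Π_ u v c x y
    recoveredBy-shatter c x y (u≤y , y≤v) ∣y∣≤k block⊆ w≤c =
      shatterΠ y , (u≤shatter y u≤y ∣y∣≤k , λ i j i∼j → y≤v i j (shatter-⊑ Y a i j i∼j)) , w≤c ,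
      shatter-⊑ Y a , λ d x≤d w≤d → shatter-join Y (part x) (part d) a block⊆ x≤d w≤d
      where Y = part y

  shatterCoatom : ∀ a → blockSize U a ≡ 1 → blockSize V a ≡ k → ∀ {b} → a ∼[ V ] b → a ≢ b →
    LeftModularCoatom
  shatterCoatom a a-singleton ∣V∣≡k {b} a∼b a≢b =
    leftModularCoatom c u≤c (shatter-⊑ V a) v≰c maximal recovers
    where
    open ShatterAt a a-singleton
    c = shatterΠ v
    ∣V∣≤k = ≤-reflexive ∣V∣≡k
    u≤c = u≤shatter v u⊑v ∣V∣≤k

    v≰c : ¬ (v ≤Π c)
    v≰c v≤c with ∼-shatter⁻ V a (v≤c a b a∼b)
    ... | inj₁ a≡b       = a≢b a≡b
    ... | inj₂ (_ , a≁a) = a≁a (refl′ V a)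

    block⊆ : ∀ x → x ≤Π v → ¬ (x ≤Π c) → ∀ {l} → a ∼[ V ] l → a ∼[ part x ] l
    block⊆ x x≤v x≰c = ⋢shatter⇒block⊆ V (part x) a x≤v (kequal x) ∣V∣≤k x≰c

    maximal : ∀ z → c ≤Π z → z ≤Π v → ¬ (z ≤Π c) → v ≤Π z
    maximal z c≤z z≤v z≰c =
      shatter-join V (part z) (part z) a (block⊆ z z≤v z≰c) (⊑-refl {p = part z}) c≤z

    recovers : Recovers _≤Π_ u v c
    recovers x y (_ , x≤v) y∈@(_ , y≤v) x≤y x≰c =
      recoveredBy-shatter c x y y∈ (≤-trans (⊑⇒blockSize≤ Y V a y≤v) ∣V∣≤k)
        (λ a∼l → block⊆ x x≤v x≰c (y≤v _ _ a∼l))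
        (shatter-mono Y V a y≤v (λ a∼l → x≤y _ _ (block⊆ x x≤v x≰c a∼l)))
      where Y = part y

  splitCoatom : ∀ a {b} → a ∼[ V ] b → ¬ (a ∼[ U ] b) → (∀ {l} → a ∼[ V ] l → blockSize U l ≢ 1) →
    LeftModularCoatom
  splitCoatom a a∼b a≁b no-singleton =
    coatom λ x y x∈ y∈ x≤y x≰c → recoveredBy-split x y x∈ y∈ x≤y x≰c (split-valid y y∈)
    where
    split-valid : ∀ y → InInterval u v y → IsKEqual k (split (part y) (same U a))
    split-valid y (u≤y , y≤v) = split-kEqual Y U a (kequal y) (kequal u) u≤y rest-large
      where
      Y = part y
      rest-large : ∀ {i} → a ∼[ Y ] i → ¬ (a ∼[ U ] i) → k ≤ blockSize (split Y (same U a)) i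
      rest-large {i} a∼i _ with kequal u i
      ... | inj₁ ∣U∣≡1 = ⊥-elim (no-singleton (y≤v _ _ a∼i) ∣U∣≡1)
      ... | inj₂ k≤∣U∣ = ≤-trans k≤∣U∣ (⊑⇒blockSize≤ U (split Y (same U a)) i (u≤split a y u≤y))
    open SplitCoatom a _ a∼b a≁b (split-valid v (u⊑v , ⊑-refl {p = V}))

  pointSplitCoatom : ∀ a → blockSize U a ≡ 1 → blockSize V a ≢ k → ∀ {b} → a ∼[ V ] b → a ≢ b →
    LeftModularCoatom
  pointSplitCoatom a a-singleton ∣V∣≢k a∼b a≢b = coatom recovers
    where
    split-valid : ∀ y → u ≤Π y → blockSize (part y) a ≢ k → IsKEqual k (split (part y) (same U a))
    split-valid y u≤y ∣y∣≢k = split-kEqual Y U a (kequal y) (kequal u) u≤y rest-large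
      where
      Y = part y
      rest-large : ∀ {i} → a ∼[ Y ] i → ¬ (a ∼[ U ] i) → k ≤ blockSize (split Y (same U a)) i
      rest-large a∼i a≁i = ≤-pred (≤-trans
        (≤∧≢⇒< (kEqual-large Y (kequal y) a∼i λ { refl → a≁i (refl′ U a) }) (≢-sym ∣y∣≢k))
        (blockSize≤1+split Y U a a-singleton a∼i a≁i))
    open SplitCoatom a _ a∼b (λ a∼b → a≢b (blockSize≡1⇒ U a-singleton a∼b)) (split-valid v u⊑v ∣V∣≢k)
    open ShatterAt a a-singleton
    crossing⇒large : ∀ x → Crosses (part x) s → k ≤ blockSize (part x) a
    crossing⇒large x (i , j , i∼j , sᵢ , sⱼ) with refl ← blockSize≡1⇒ U a-singleton (≡true⇒T sᵢ) =
      kEqual-large (part x) (kequal x) i∼j λ { refl → case trans (sym sᵢ) sⱼ of λ () }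
    recovers : Recovers _≤Π_ u v c
    recovers x y x∈@(_ , x≤v) y∈@(u≤y , y≤v) x≤y x≰c with blockSize (part y) a ℕ.≟ k
    ... | no  ∣y∣≢k = recoveredBy-split x y x∈ y∈ x≤y x≰c (split-valid y u≤y ∣y∣≢k)
    ... | yes ∣y∣≡k = recoveredBy-shatter c x y y∈ (≤-reflexive ∣y∣≡k) block⊆ w≤c
      where
      X = part x
      Y = part y
      block⊆ : ∀ {l} → a ∼[ Y ] l → a ∼[ X ] l
      block⊆ = blockSize-fill X a Y a (x≤y a _)
        (subst (_≤ blockSize X a) (sym ∣y∣≡k) (crossing⇒large x (split-crossing V s X x≤v x≰c)))
      w≤c : shatter Y a ⊑ split V s
      w≤c i j i∼j = split-mono Y V s y≤v i j (shatter⊑split Y U a u≤y i j i∼j)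

theorem6p1 : ∀ (n k : ℕ) → 1 ≤ k → k ≤ n →
    Order.Comodernistic (_≤Π_ {n} {k})
theorem6p1 n k _ _ u v (u⊑v , v⋢u)
  with a , b , a∼b , a≁b ← ⋢⇒pair (part v) (part u) v⋢u
  with any? (λ a′ → ∼-dec (part v) a a′ ×-dec (blockSize (part u) a′ ℕ.≟ 1))
... | no no-singleton = splitCoatom u v u⊑v a a∼b a≁b λ a∼l ∣U∣≡1 → no-singleton (_ , a∼l , ∣U∣≡1)
... | yes (a′ , a∼a′ , a′-singleton)
  with b′ , a′∼b′ , a′≢b′ ← distinct-neighbour (part v) a∼a′ a∼b (λ { refl → a≁b (refl′ (part u) a) })
  with blockSize (part v) a′ ℕ.≟ k
... | yes ∣V∣≡k = shatterCoatom u v u⊑v a′ a′-singleton ∣V∣≡k a′∼b′ a′≢b′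
... | no  ∣V∣≢k = pointSplitCoatom u v u⊑v a′ a′-singleton ∣V∣≢k a′∼b′ a′≢b′
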